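{- Let $a,b$ be positive integers, let $0\le k\le b-1$ (with $k=0$ if $a=1$), and let $\nu=EN^{a-1}E^{b-1}N$. Let $\mu$ be an element of $\mathsf{H}_{\delta(k)}(a,b)$, that is, a $\nu$-path. Underlined entries below mark the fixed positions. The $\widehat\nu(k)$-bracket vector of $\mu$ has the form $$\mathbf b(\mu)=(\alpha,s,\underline 0,\underline 1,\dots,\underline{a-2},\beta,\underline{a-1},\underline a)\ \text{ if } a>1,\qquad \mathbf b(\mu)=(\gamma,s,\underline0,\underline1)\ \text{ if } a=1,$$ where the non-fixed blocks $\alpha,\beta,\gamma$ and the non-fixed entry $s$ satisfy the following. (1) If $a>1$, then: - $0\le s\le a$; - $\alpha$ has $b-k-1$ entries and $\beta$ has $k$ entries; - $(\alpha,\beta)=(a^{t},(a-1)^{b-1-t})$, meaning $t$ entries equal to $a$ followed by $b-1-t$ entries equal to $a-1$; - here $0\le t\le b-1-k$ if $s=a-1$, $b-1-k\le t\le b-1$ if $s=a$, and $0\le t\le b-1$ if $0\le s\le a-2$. (2) If $a=1$, then: - $0\le s\le 1$; - $\gamma$ has $b-1$ entries and equals $(1^t,0^{b-1-t})$; - here $t=b-1$ if $s=1$, and $0\le t\le b-1$ if $s=0$.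
   Context: A lattice path is a finite word in $N$ (unit north step) and $E$ (unit east step), drawn from the origin; exponents denote repetition. For a lattice path $\nu$, a $\nu$-path is a lattice path with the same endpoints as $\nu$ that stays weakly above $\nu$. $\mathsf{H}_{\delta(k)}(a,b)$ is the alt $\nu$-Tamari lattice on the set of $\nu$-paths for $\nu=EN^{a-1}E^{b-1}N$ with increment vector $\delta(k)$; only its underlying set matters here. Define $\widehat\nu(k)=E^{b-k}N^{a-1}E^kN$ if $a>1$, and $\widehat\nu(0)=E^bN$ if $a=1$. Every $\nu$-path stays weakly above $\widehat\nu(k)$. Bracket vectors are defined as follows. Let $\rho$ be a lattice path from $(0,0)$ to $(r-n,n)$. Let $\mathbf a(\rho)=(a_0,\dots,a_r)$ be the list of $y$-coordinates of the lattice points of $\rho$ in order. For $0\le i\le n$, the fixed position $f_i$ is the largest index with $a_{f_i}=i$. For a $\rho$-path $\mu$, its $\rho$-bracket vector $\mathbf b(\mu)=(b_0,\dots,b_r)$ (indexed from $0$) is built as follows: (i) set $b_{f_i}=i$ for each $i$; (ii) for $i=0,1,\dots,n$ in turn, let $g_i$ be the number of entries equal to $i$ in $\mathbf a(\mu)$; then, scanning from right to left among the still-unassigned positions to the left of $f_i$, assign the value $i$ to the first $g_i-1$ such positions. Here this is applied with $\rho=\widehat\nu(k)$. -}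

module Defs where

open import Data.Nat using (ℕ; zero; suc; _+_; _∸_; _≤_; _<_; _≡ᵇ_)
open import Data.List using (List; []; _∷_; _++_; map; replicate; take; drop; reverse; foldl; upTo; length)
open import Data.Maybe using (Maybe; just; nothing)
open import Data.Bool using (Bool; true; false; if_then_else_)
open import Data.Product using (_×_)
open import Relation.Binary.PropositionalEquality using (_≡_)

data Step : Set where
  N E : Step

Path : Set
Path = List Step

northCount : Path → ℕ
northCount [] = 0
northCount (N ∷ p) = suc (northCount p)
northCount (E ∷ p) = northCount p

eastCount : Path → ℕ
eastCount [] = 0
eastCount (N ∷ p) = eastCount p
eastCount (E ∷ p) = suc (eastCount p)

-- μ is a ν-path: same endpoints as ν (both start at the origin) and μ stays
-- weakly above ν, i.e. every prefix of μ has at least as many north steps as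
-- the prefix of ν of the same length.
IsPathAbove : Path → Path → Set
IsPathAbove ν μ =
  northCount μ ≡ northCount ν × eastCount μ ≡ eastCount ν ×
  (∀ i → northCount (take i ν) ≤ northCount (take i μ))

nu : ℕ → ℕ → Path
nu a b = E ∷ replicate (a ∸ 1) N ++ replicate (b ∸ 1) E ++ N ∷ []

nuHat : ℕ → ℕ → ℕ → Path
nuHat (suc (suc a')) b k = replicate (b ∸ k) E ++ replicate (suc a') N ++ replicate k E ++ N ∷ []
nuHat (suc zero) b k = replicate b E ++ N ∷ []
nuHat zero b k = []   -- not used (a ≥ 1)

-- a(ρ): the y-coordinates of the lattice points of ρ, in order.
ys : Path → List ℕ
ys [] = 0 ∷ []
ys (N ∷ p) = 0 ∷ map suc (ys p)
ys (E ∷ p) = 0 ∷ ys p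

count : ℕ → List ℕ → ℕ
count i [] = 0
count i (x ∷ xs) = if x ≡ᵇ i then suc (count i xs) else count i xs

lastIndex : ℕ → List ℕ → Maybe ℕ
lastIndex i [] = nothing
lastIndex i (x ∷ xs) with lastIndex i xs
... | just j = just (suc j)
... | nothing = if x ≡ᵇ i then just 0 else nothing

-- Step (i): position j is fixed iff it is the largest index carrying its
-- value a_j (no later entry equals a_j); there b_j = a_j. Others unassigned.
initVec : List ℕ → List (Maybe ℕ)
initVec [] = []
initVec (x ∷ xs) = (if count x xs ≡ᵇ 0 then just x else nothing) ∷ initVec xs

fillFirst : ℕ → ℕ → List (Maybe ℕ) → List (Maybe ℕ)
fillFirst zero v xs = xs
fillFirst (suc c) v [] = []
fillFirst (suc c) v (nothing ∷ xs) = just v ∷ fillFirst c v xs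
fillFirst (suc c) v (just x ∷ xs) = just x ∷ fillFirst (suc c) v xs

-- Step (ii) for the value i: among unassigned positions left of f_i, scanning
-- right to left, assign i to the first g_i - 1 of them.
bracketStep : List ℕ → List ℕ → List (Maybe ℕ) → ℕ → List (Maybe ℕ)
bracketStep aρ aμ vec i with lastIndex i aρ
... | just f = reverse (fillFirst (count i aμ ∸ 1) i (reverse (take f vec))) ++ drop f vec
... | nothing = vec

-- ρ-bracket vector of μ (entries 'nothing' would mean unassigned).
bracketVector : Path → Path → List (Maybe ℕ)
bracketVector ρ μ =
  foldl (bracketStep (ys ρ) (ys μ)) (initVec (ys ρ)) (upTo (suc (northCount ρ)))

-- Write a = A + 1 and b = P + k + 1, so that ν̂(k) = E^(P+1) N^A E^k N. Its
-- heights are 0^(P+1), 0, 1, …, A-1, A^k, A, A+1: in the bracket vector the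
-- values 0, …, A-1 of the middle block and the last two entries A, A+1 are fixed,
-- while the P+1 slots in front and the k slots after the middle block are free.
-- A ν-path visits every height below A exactly once, except that a path whose
-- first east step occurs at height j < A visits j twice; it visits A m+1 times
-- and A+1 e+1 times, where m + e is the number of slots still free after the
-- steps below A. Those steps do nothing, except that the step for j writes j into the
-- free slot just in front of the middle block (this is s). The steps for A and
-- A+1 then fill the remaining free slots from the right, with m copies of A and
-- then e copies of A+1, which uses all of them. So the free slots read
-- (A+1)^e A^m, and s and t are determined by where the slot in front of the
-- middle block falls in this word.

module Submission where

open import Defs
open import Data.Bool using (true; false; if_then_else_)
open import Data.Empty using (⊥-elim)
open import Data.List
  using (List; []; _∷_; _++_; _∷ʳ_; map; replicate; take; drop; reverse; foldl; upTo; length)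
open import Data.List.Properties
  using (++-assoc; ++-identityʳ; ∷-injectiveˡ; ∷-injectiveʳ; map-id; map-∘; map-++; map-replicate; map-upTo;
         length-++; length-map; length-replicate; length-reverse; length-take; length-drop; length-upTo;
         take++drop≡id; reverse-++; reverse-involutive; reverse-map; foldl-++; foldl-∷ʳ; upTo-∷ʳ)
open import Data.List.Relation.Unary.All as All using (All; []; _∷_)
open import Data.List.Relation.Unary.All.Properties using (++⁺; replicate⁺)
open import Data.Maybe using (Maybe; just; nothing; _<∣>_)
open import Data.Nat using (ℕ; zero; suc; _+_; _∸_; _⊓_; _≤_; _<_; z≤n; s≤s; _≡ᵇ_)
open import Data.Nat.Properties
open import Data.Nat.Tactic.RingSolver using (solve-∀)
open import Data.Product using (_×_; _,_; ∃-syntax; proj₁; proj₂)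
open import Data.Sum using (_⊎_; inj₁; inj₂)
open import Function using (_∘′_)
open import Relation.Binary.Definitions using (tri<; tri≈; tri>)
open import Relation.Binary.PropositionalEquality
open ≡-Reasoning

replicate-+ : ∀ {X : Set} m n (x : X) → replicate (m + n) x ≡ replicate m x ++ replicate n x
replicate-+ zero    n x = refl
replicate-+ (suc m) n x = cong (x ∷_) (replicate-+ m n x)

take-length-++ : ∀ {X : Set} (xs ys : List X) → take (length xs) (xs ++ ys) ≡ xs
take-length-++ []       ys = refl
take-length-++ (x ∷ xs) ys = cong (x ∷_) (take-length-++ xs ys)

drop-length-++ : ∀ {X : Set} (xs ys : List X) → drop (length xs) (xs ++ ys) ≡ ys
drop-length-++ []       ys = refl
drop-length-++ (x ∷ xs) ys = drop-length-++ xs ys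

++-cancel-length : ∀ {X : Set} (xs ys : List X) {zs ws} →
  length xs ≡ length ys → xs ++ zs ≡ ys ++ ws → xs ≡ ys × zs ≡ ws
++-cancel-length []       []       _  eq = refl , eq
++-cancel-length (x ∷ xs) (y ∷ ys) same-length eq
  with ++-cancel-length xs ys (suc-injective same-length) (∷-injectiveʳ eq)
... | xs≡ys , zs≡ws = cong₂ _∷_ (∷-injectiveˡ eq) xs≡ys , zs≡ws

++-assoc₃ : ∀ {X : Set} (xs ys zs ws : List X) → (xs ++ ys ++ zs) ++ ws ≡ xs ++ ys ++ zs ++ ws
++-assoc₃ xs ys zs ws = trans (++-assoc xs (ys ++ zs) ws) (cong (xs ++_) (++-assoc ys zs ws))

length≡0⇒[] : ∀ {X : Set} (xs : List X) → length xs ≡ 0 → xs ≡ []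
length≡0⇒[] [] _ = refl

foldl-upTo-inert : ∀ {X : Set} (f : X → ℕ → X) v n → (∀ i → i < n → ∀ w → f w i ≡ w) → foldl f v (upTo n) ≡ v
foldl-upTo-inert f v zero    inert = refl
foldl-upTo-inert f v (suc n) inert = begin
  foldl f v (upTo (suc n))      ≡⟨ cong (foldl f v) (sym (upTo-∷ʳ n)) ⟩
  foldl f v (upTo n ∷ʳ n)       ≡⟨ foldl-∷ʳ f v n (upTo n) ⟩
  f (foldl f v (upTo n)) n      ≡⟨ cong (λ w → f w n) (foldl-upTo-inert f v n (λ i i<n → inert i (m<n⇒m<1+n i<n))) ⟩
  f v n                         ≡⟨ inert n (n<1+n n) v ⟩
  v                             ∎

foldl-upTo-single : ∀ {X : Set} (f : X → ℕ → X) v n {j} → j < n →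
  (∀ i → i < n → i ≢ j → ∀ w → f w i ≡ w) → foldl f v (upTo n) ≡ f v j
foldl-upTo-single f v (suc n) {j} j<1+n inert = begin
  foldl f v (upTo (suc n))      ≡⟨ cong (foldl f v) (sym (upTo-∷ʳ n)) ⟩
  foldl f v (upTo n ∷ʳ n)       ≡⟨ foldl-∷ʳ f v n (upTo n) ⟩
  f (foldl f v (upTo n)) n      ≡⟨ last (m<1+n⇒m<n∨m≡n j<1+n) ⟩
  f v j                         ∎
  where
  inert′ : ∀ i → i < n → i ≢ j → ∀ w → f w i ≡ w
  inert′ i i<n = inert i (m<n⇒m<1+n i<n)
  last : j < n ⊎ j ≡ n → f (foldl f v (upTo n)) n ≡ f v j
  last (inj₁ j<n)  = trans (inert n (n<1+n n) (λ n≡j → <⇒≢ j<n (sym n≡j)) _)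
                           (foldl-upTo-single f v n j<n inert′)
  last (inj₂ refl) = cong (λ w → f w j) (foldl-upTo-inert f v j (λ i i<j → inert′ i i<j (<⇒≢ i<j)))

-- Filling holes

holes : List (Maybe ℕ) → ℕ
holes []            = 0
holes (nothing ∷ xs) = suc (holes xs)
holes (just _ ∷ xs)  = holes xs

holes-++ : ∀ xs ys → holes (xs ++ ys) ≡ holes xs + holes ys
holes-++ []            ys = refl
holes-++ (nothing ∷ xs) ys = cong suc (holes-++ xs ys)
holes-++ (just _ ∷ xs)  ys = holes-++ xs ys

holes-map-just : ∀ ws → holes (map just ws) ≡ 0
holes-map-just []       = refl
holes-map-just (_ ∷ ws) = holes-map-just ws

holes-reverse : ∀ xs → holes (reverse xs) ≡ holes xs
holes-reverse []       = refl
holes-reverse (x ∷ xs) = begin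
  holes (reverse (x ∷ xs))           ≡⟨ cong holes (reverse-++ (x ∷ []) xs) ⟩
  holes (reverse xs ++ x ∷ [])       ≡⟨ holes-++ (reverse xs) (x ∷ []) ⟩
  holes (reverse xs) + holes (x ∷ []) ≡⟨ cong (_+ holes (x ∷ [])) (holes-reverse xs) ⟩
  holes xs + holes (x ∷ [])           ≡⟨ +-comm (holes xs) _ ⟩
  holes (x ∷ []) + holes xs           ≡⟨ sym (holes-++ (x ∷ []) xs) ⟩
  holes (x ∷ xs)                      ∎

holes-replicate : ∀ n → holes (replicate n nothing) ≡ n
holes-replicate zero    = refl
holes-replicate (suc n) = cong suc (holes-replicate n)

length-holes-around : ∀ n (ms : List ℕ) k → length (replicate n nothing ++ map just ms ++ replicate k nothing) ≡ n + length ms + k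
length-holes-around n ms k = begin
  length (replicate n nothing ++ map just ms ++ replicate k nothing)
    ≡⟨ length-++ (replicate n nothing) ⟩
  length (replicate n nothing) + length (map just ms ++ replicate k nothing)
    ≡⟨ cong₂ _+_ (length-replicate n) (length-++ (map just ms)) ⟩
  n + (length (map just ms) + length (replicate k nothing))
    ≡⟨ cong₂ (λ x y → n + (x + y)) (length-map just ms) (length-replicate k) ⟩
  n + (length ms + k)
    ≡⟨ sym (+-assoc n (length ms) k) ⟩
  n + length ms + k ∎

fillLast : ℕ → ℕ → List (Maybe ℕ) → List (Maybe ℕ)
fillLast c v xs = reverse (fillFirst c v (reverse xs))

fillFirst-++ : ∀ c v xs ys → fillFirst c v (xs ++ ys) ≡ fillFirst c v xs ++ fillFirst (c ∸ holes xs) v ys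
fillFirst-++ zero    v xs            ys rewrite 0∸n≡0 (holes xs) = refl
fillFirst-++ (suc c) v []            ys = refl
fillFirst-++ (suc c) v (nothing ∷ xs) ys = cong (just v ∷_) (fillFirst-++ c v xs ys)
fillFirst-++ (suc c) v (just x ∷ xs)  ys = cong (just x ∷_) (fillFirst-++ (suc c) v xs ys)

fillLast-++ : ∀ c v xs ys → fillLast c v (xs ++ ys) ≡ fillLast (c ∸ holes ys) v xs ++ fillLast c v ys
fillLast-++ c v xs ys = begin
  reverse (fillFirst c v (reverse (xs ++ ys)))
    ≡⟨ cong (reverse ∘′ fillFirst c v) (reverse-++ xs ys) ⟩
  reverse (fillFirst c v (reverse ys ++ reverse xs))
    ≡⟨ cong reverse (fillFirst-++ c v (reverse ys) (reverse xs)) ⟩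
  reverse (fillFirst c v (reverse ys) ++ fillFirst (c ∸ holes (reverse ys)) v (reverse xs))
    ≡⟨ reverse-++ (fillFirst c v (reverse ys)) _ ⟩
  fillLast (c ∸ holes (reverse ys)) v xs ++ fillLast c v ys
    ≡⟨ cong (λ h → fillLast (c ∸ h) v xs ++ fillLast c v ys) (holes-reverse ys) ⟩
  fillLast (c ∸ holes ys) v xs ++ fillLast c v ys ∎

fillFirst-complete : ∀ c v xs → holes xs ≤ c → fillFirst c v xs ≡ map (_<∣> just v) xs
fillFirst-complete zero    v []            _         = refl
fillFirst-complete zero    v (just x ∷ xs)  h≤c       = cong (just x ∷_) (fillFirst-complete zero v xs h≤c)
fillFirst-complete (suc c) v []            _         = refl
fillFirst-complete (suc c) v (nothing ∷ xs) (s≤s h≤c) = cong (just v ∷_) (fillFirst-complete c v xs h≤c)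
fillFirst-complete (suc c) v (just x ∷ xs)  h≤c       = cong (just x ∷_) (fillFirst-complete (suc c) v xs h≤c)

fillLast-complete : ∀ c v xs → holes xs ≤ c → fillLast c v xs ≡ map (_<∣> just v) xs
fillLast-complete c v xs h≤c = begin
  reverse (fillFirst c v (reverse xs))
    ≡⟨ cong reverse (fillFirst-complete c v (reverse xs) (subst (_≤ c) (sym (holes-reverse xs)) h≤c)) ⟩
  reverse (map (_<∣> just v) (reverse xs)) ≡⟨ cong reverse (reverse-map (_<∣> just v) xs) ⟩
  reverse (reverse (map (_<∣> just v) xs)) ≡⟨ reverse-involutive _ ⟩
  map (_<∣> just v) xs                     ∎

fillLast-zero : ∀ v xs → fillLast 0 v xs ≡ xs
fillLast-zero v = reverse-involutive

length-fillFirst : ∀ c v xs → length (fillFirst c v xs) ≡ length xs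
length-fillFirst zero    v xs            = refl
length-fillFirst (suc c) v []            = refl
length-fillFirst (suc c) v (nothing ∷ xs) = cong suc (length-fillFirst c v xs)
length-fillFirst (suc c) v (just x ∷ xs)  = cong suc (length-fillFirst (suc c) v xs)

length-fillLast : ∀ c v xs → length (fillLast c v xs) ≡ length xs
length-fillLast c v xs = begin
  length (reverse (fillFirst c v (reverse xs))) ≡⟨ length-reverse (fillFirst c v (reverse xs)) ⟩
  length (fillFirst c v (reverse xs))           ≡⟨ length-fillFirst c v (reverse xs) ⟩
  length (reverse xs)                           ≡⟨ length-reverse xs ⟩
  length xs                                     ∎

fillLast-map-just : ∀ c v ws → fillLast c v (map just ws) ≡ map just ws
fillLast-map-just c v ws = begin
  fillLast c v (map just ws)     ≡⟨ fillLast-complete c v (map just ws) (subst (_≤ c) (sym (holes-map-just ws)) z≤n) ⟩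
  map (_<∣> just v) (map just ws) ≡⟨ sym (map-∘ ws) ⟩
  map just ws                     ∎

fillLast-++-map-just : ∀ c v xs ws → fillLast c v (xs ++ map just ws) ≡ fillLast c v xs ++ map just ws
fillLast-++-map-just c v xs ws = begin
  fillLast c v (xs ++ map just ws)                            ≡⟨ fillLast-++ c v xs (map just ws) ⟩
  fillLast (c ∸ holes (map just ws)) v xs ++ fillLast c v (map just ws)
    ≡⟨ cong₂ (λ h ys → fillLast (c ∸ h) v xs ++ ys) (holes-map-just ws) (fillLast-map-just c v ws) ⟩
  fillLast c v xs ++ map just ws                              ∎

fillLast-replicate-all : ∀ c v → fillLast c v (replicate c nothing) ≡ replicate c (just v)
fillLast-replicate-all c v = begin
  fillLast c v (replicate c nothing)        ≡⟨ fillLast-complete c v (replicate c nothing) (≤-reflexive (holes-replicate c)) ⟩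
  map (_<∣> just v) (replicate c nothing)  ≡⟨ map-replicate (_<∣> just v) c nothing ⟩
  replicate c (just v)                      ∎

fillLast-replicate : ∀ c d v → fillLast c v (replicate (c + d) nothing) ≡ replicate d nothing ++ replicate c (just v)
fillLast-replicate c d v = begin
  fillLast c v (replicate (c + d) nothing)
    ≡⟨ cong (fillLast c v) (trans (cong (λ n → replicate n nothing) (+-comm c d)) (replicate-+ d c nothing)) ⟩
  fillLast c v (replicate d nothing ++ replicate c nothing)
    ≡⟨ fillLast-++ c v (replicate d nothing) (replicate c nothing) ⟩
  fillLast (c ∸ holes (replicate c nothing)) v (replicate d nothing) ++ fillLast c v (replicate c nothing)
    ≡⟨ cong₂ (λ h ys → fillLast (c ∸ h) v (replicate d nothing) ++ ys) (holes-replicate c) (fillLast-replicate-all c v) ⟩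
  fillLast (c ∸ c) v (replicate d nothing) ++ replicate c (just v)
    ≡⟨ cong (λ n → fillLast n v (replicate d nothing) ++ replicate c (just v)) (n∸n≡0 c) ⟩
  fillLast 0 v (replicate d nothing) ++ replicate c (just v)
    ≡⟨ cong (_++ replicate c (just v)) (fillLast-zero v (replicate d nothing)) ⟩
  replicate d nothing ++ replicate c (just v) ∎

fillLast-twice-replicate : ∀ m e v w →
  fillLast e w (fillLast m v (replicate (m + e) nothing)) ≡ map just (replicate e w ++ replicate m v)
fillLast-twice-replicate m e v w = begin
  fillLast e w (fillLast m v (replicate (m + e) nothing))
    ≡⟨ cong (fillLast e w) (trans (fillLast-replicate m e v) (cong (replicate e nothing ++_) (sym (map-replicate just m v)))) ⟩
  fillLast e w (replicate e nothing ++ map just (replicate m v))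
    ≡⟨ fillLast-++-map-just e w (replicate e nothing) (replicate m v) ⟩
  fillLast e w (replicate e nothing) ++ map just (replicate m v)
    ≡⟨ cong (_++ map just (replicate m v)) (trans (fillLast-replicate-all e w) (sym (map-replicate just e w))) ⟩
  map just (replicate e w) ++ map just (replicate m v)
    ≡⟨ sym (map-++ just (replicate e w) (replicate m v)) ⟩
  map just (replicate e w ++ replicate m v) ∎

fillLast-insert : ∀ c v X ms Y →
  fillLast c v (X ++ map just ms ++ Y) ≡ fillLast (c ∸ holes Y) v X ++ map just ms ++ fillLast c v Y
fillLast-insert c v X ms Y = begin
  fillLast c v (X ++ map just ms ++ Y)
    ≡⟨ fillLast-++ c v X (map just ms ++ Y) ⟩
  fillLast (c ∸ holes (map just ms ++ Y)) v X ++ fillLast c v (map just ms ++ Y)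
    ≡⟨ cong₂ (λ h ys → fillLast (c ∸ h) v X ++ ys)
             (trans (holes-++ (map just ms) Y) (cong (_+ holes Y) (holes-map-just ms)))
             (fillLast-++ c v (map just ms) Y) ⟩
  fillLast (c ∸ holes Y) v X ++ fillLast (c ∸ holes Y) v (map just ms) ++ fillLast c v Y
    ≡⟨ cong (λ zs → fillLast (c ∸ holes Y) v X ++ zs ++ fillLast c v Y) (fillLast-map-just (c ∸ holes Y) v ms) ⟩
  fillLast (c ∸ holes Y) v X ++ map just ms ++ fillLast c v Y ∎

-- Filling commutes with inserting a block of fixed entries, so once all holes
-- are filled the block ends up exactly at the seam between α and β.
fillLast-twice-insert : ∀ c₁ c₂ v₁ v₂ X ms Y α β →
  fillLast c₂ v₂ (fillLast c₁ v₁ (X ++ Y)) ≡ map just (α ++ β) → length α ≡ length X →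
  fillLast c₂ v₂ (fillLast c₁ v₁ (X ++ map just ms ++ Y)) ≡ map just (α ++ ms ++ β)
fillLast-twice-insert c₁ c₂ v₁ v₂ X ms Y α β filled |α| = begin
  fillLast c₂ v₂ (fillLast c₁ v₁ (X ++ map just ms ++ Y)) ≡⟨ cong (fillLast c₂ v₂) (fillLast-insert c₁ v₁ X ms Y) ⟩
  fillLast c₂ v₂ (X₁ ++ map just ms ++ Y₁)              ≡⟨ fillLast-insert c₂ v₂ X₁ ms Y₁ ⟩
  X₂ ++ map just ms ++ Y₂                                ≡⟨ cong₂ (λ xs ys → xs ++ map just ms ++ ys) X₂≡α Y₂≡β ⟩
  map just α ++ map just ms ++ map just β               ≡⟨ sym (trans (map-++ just α _) (cong (map just α ++_) (map-++ just ms β))) ⟩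
  map just (α ++ ms ++ β)                                ∎
  where
  X₁ = fillLast (c₁ ∸ holes Y) v₁ X
  Y₁ = fillLast c₁ v₁ Y
  X₂ = fillLast (c₂ ∸ holes Y₁) v₂ X₁
  Y₂ = fillLast c₂ v₂ Y₁
  X₂++Y₂ : X₂ ++ Y₂ ≡ map just α ++ map just β
  X₂++Y₂ = begin
    X₂ ++ Y₂                                  ≡⟨ sym (fillLast-++ c₂ v₂ X₁ Y₁) ⟩
    fillLast c₂ v₂ (X₁ ++ Y₁)                 ≡⟨ cong (fillLast c₂ v₂) (sym (fillLast-++ c₁ v₁ X Y)) ⟩
    fillLast c₂ v₂ (fillLast c₁ v₁ (X ++ Y))  ≡⟨ filled ⟩
    map just (α ++ β)                         ≡⟨ map-++ just α β ⟩
    map just α ++ map just β                  ∎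
  |X₂| : length X₂ ≡ length (map just α)
  |X₂| = trans (length-fillLast (c₂ ∸ holes Y₁) v₂ X₁) (trans (length-fillLast (c₁ ∸ holes Y) v₁ X) (sym (trans (length-map just α) |α|)))
  X₂≡α = proj₁ (++-cancel-length X₂ (map just α) |X₂| X₂++Y₂)
  Y₂≡β = proj₂ (++-cancel-length X₂ (map just α) |X₂| X₂++Y₂)

-- Steps of the bracket-vector construction

≡ᵇ-refl : ∀ n → (n ≡ᵇ n) ≡ true
≡ᵇ-refl zero    = refl
≡ᵇ-refl (suc n) = ≡ᵇ-refl n

>⇒≡ᵇ-false : ∀ {m n} → m < n → (n ≡ᵇ m) ≡ false
>⇒≡ᵇ-false {zero}  {suc n} _         = refl
>⇒≡ᵇ-false {suc m} {suc n} (s≤s m<n) = >⇒≡ᵇ-false m<n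

bracketStep-at : ∀ aρ aμ pre post i → lastIndex i aρ ≡ just (length pre) →
  bracketStep aρ aμ (pre ++ post) i ≡ fillLast (count i aμ ∸ 1) i pre ++ post
bracketStep-at aρ aμ pre post i f≡ rewrite f≡ | take-length-++ pre post | drop-length-++ pre post = refl

bracketStep-inert : ∀ aρ aμ vec i → count i aμ ≤ 1 → bracketStep aρ aμ vec i ≡ vec
bracketStep-inert aρ aμ vec i c≤1 with lastIndex i aρ
... | nothing = refl
... | just f rewrite m≤n⇒m∸n≡0 c≤1 | reverse-involutive (take f vec) = take++drop≡id f vec

lastIndex-++-just : ∀ i xs ys f → lastIndex i ys ≡ just f → lastIndex i (xs ++ ys) ≡ just (length xs + f)
lastIndex-++-just i []       ys f eq = eq
lastIndex-++-just i (x ∷ xs) ys f eq rewrite lastIndex-++-just i xs ys f eq = refl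

lastIndex-++-nothing : ∀ i xs ys → lastIndex i ys ≡ nothing → lastIndex i (xs ++ ys) ≡ lastIndex i xs
lastIndex-++-nothing i []       ys eq = eq
lastIndex-++-nothing i (x ∷ xs) ys eq rewrite lastIndex-++-nothing i xs ys eq = refl

lastIndex-above : ∀ {i xs} → All (i <_) xs → lastIndex i xs ≡ nothing
lastIndex-above []                      = refl
lastIndex-above {i} {x ∷ xs} (i<x ∷ ps) rewrite lastIndex-above ps | >⇒≡ᵇ-false i<x = refl

lastIndex-∷ : ∀ i xs → lastIndex i xs ≡ nothing → lastIndex i (i ∷ xs) ≡ just 0
lastIndex-∷ i xs eq rewrite eq | ≡ᵇ-refl i = refl

lastIndex-upTo : ∀ {i n} → i < n → lastIndex i (upTo n) ≡ just i
lastIndex-upTo {i} {suc n} i<1+n = trans (cong (lastIndex i) (sym (upTo-∷ʳ n))) (last (m<1+n⇒m<n∨m≡n i<1+n))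
  where
  last : i < n ⊎ i ≡ n → lastIndex i (upTo n ++ n ∷ []) ≡ just i
  last (inj₁ i<n)  = trans (lastIndex-++-nothing i (upTo n) (n ∷ []) (lastIndex-above (i<n ∷ []))) (lastIndex-upTo i<n)
  last (inj₂ refl) = trans (lastIndex-++-just i (upTo i) (i ∷ []) 0 (lastIndex-∷ i [] refl))
                           (cong just (trans (+-identityʳ _) (length-upTo i)))

count-above : ∀ {i xs} → All (i <_) xs → count i xs ≡ 0
count-above []                      = refl
count-above {i} {x ∷ xs} (i<x ∷ ps) rewrite >⇒≡ᵇ-false i<x = count-above ps

count-replicate-++ : ∀ x n ys → count x (replicate n x ++ ys) ≡ n + count x ys
count-replicate-++ x zero    ys = refl
count-replicate-++ x (suc n) ys rewrite ≡ᵇ-refl x = cong suc (count-replicate-++ x n ys)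

count-map-suc : ∀ i xs → count (suc i) (map suc xs) ≡ count i xs
count-map-suc i []       = refl
count-map-suc i (x ∷ xs) with x ≡ᵇ i
... | true  = cong suc (count-map-suc i xs)
... | false = count-map-suc i xs

count-zero-map-suc : ∀ xs → count 0 (map suc xs) ≡ 0
count-zero-map-suc []       = refl
count-zero-map-suc (x ∷ xs) = count-zero-map-suc xs

northCount-replicate-E : ∀ n q → northCount (replicate n E ++ q) ≡ northCount q
northCount-replicate-E zero    q = refl
northCount-replicate-E (suc n) q = northCount-replicate-E n q

northCount-replicate-N : ∀ n q → northCount (replicate n N ++ q) ≡ n + northCount q
northCount-replicate-N zero    q = refl
northCount-replicate-N (suc n) q = cong suc (northCount-replicate-N n q)

eastCount-replicate-E : ∀ n q → eastCount (replicate n E ++ q) ≡ n + eastCount q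
eastCount-replicate-E zero    q = refl
eastCount-replicate-E (suc n) q = cong suc (eastCount-replicate-E n q)

eastCount-replicate-N : ∀ n q → eastCount (replicate n N ++ q) ≡ eastCount q
eastCount-replicate-N zero    q = refl
eastCount-replicate-N (suc n) q = eastCount-replicate-N n q

-- The bracket vector for ν̂(k)

-- ν̂(k) for a = A + 1 and b = P + k + 1; for a = 1 (hence k = 0) this is E^b N.
hatPath : ℕ → ℕ → ℕ → Path
hatPath P A k = replicate (suc P) E ++ replicate A N ++ replicate k E ++ N ∷ []

heights : ℕ → ℕ → ℕ → List ℕ
heights P A k = replicate (suc P) 0 ++ upTo A ++ replicate k A ++ A ∷ suc A ∷ []

ys-replicate-E : ∀ n q → ys (replicate n E ++ q) ≡ replicate n 0 ++ ys q
ys-replicate-E zero    q = refl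
ys-replicate-E (suc n) q = cong (0 ∷_) (ys-replicate-E n q)

ys-replicate-N : ∀ n q → ys (replicate n N ++ q) ≡ upTo n ++ map (n +_) (ys q)
ys-replicate-N zero    q = sym (map-id (ys q))
ys-replicate-N (suc n) q = begin
  0 ∷ map suc (ys (replicate n N ++ q))               ≡⟨ cong (λ zs → 0 ∷ map suc zs) (ys-replicate-N n q) ⟩
  0 ∷ map suc (upTo n ++ map (n +_) (ys q))           ≡⟨ cong (0 ∷_) (map-++ suc (upTo n) _) ⟩
  0 ∷ map suc (upTo n) ++ map suc (map (n +_) (ys q)) ≡⟨ cong₂ (λ xs zs → 0 ∷ xs ++ zs) (map-upTo suc n) (sym (map-∘ (ys q))) ⟩
  upTo (suc n) ++ map (suc n +_) (ys q)               ∎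

ys-hatPath : ∀ P A k → ys (hatPath P A k) ≡ heights P A k
ys-hatPath P A k = begin
  ys (hatPath P A k)
    ≡⟨ ys-replicate-E (suc P) _ ⟩
  replicate (suc P) 0 ++ ys (replicate A N ++ replicate k E ++ N ∷ [])
    ≡⟨ cong (replicate (suc P) 0 ++_) (ys-replicate-N A _) ⟩
  replicate (suc P) 0 ++ upTo A ++ map (A +_) (ys (replicate k E ++ N ∷ []))
    ≡⟨ cong (λ zs → replicate (suc P) 0 ++ upTo A ++ map (A +_) zs) (ys-replicate-E k (N ∷ [])) ⟩
  replicate (suc P) 0 ++ upTo A ++ map (A +_) (replicate k 0 ++ 0 ∷ 1 ∷ [])
    ≡⟨ cong (λ zs → replicate (suc P) 0 ++ upTo A ++ zs) (map-++ (A +_) (replicate k 0) _) ⟩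
  replicate (suc P) 0 ++ upTo A ++ map (A +_) (replicate k 0) ++ A + 0 ∷ A + 1 ∷ []
    ≡⟨ cong (λ zs → replicate (suc P) 0 ++ upTo A ++ zs ++ A + 0 ∷ A + 1 ∷ []) (map-replicate (A +_) k 0) ⟩
  replicate (suc P) 0 ++ upTo A ++ replicate k (A + 0) ++ A + 0 ∷ A + 1 ∷ []
    ≡⟨ cong₂ (λ x y → replicate (suc P) 0 ++ upTo A ++ replicate k x ++ x ∷ y ∷ []) (+-identityʳ A) (+-comm A 1) ⟩
  heights P A k ∎

northCount-hatPath : ∀ P A k → northCount (hatPath P A k) ≡ suc A
northCount-hatPath P A k = begin
  northCount (hatPath P A k)                           ≡⟨ northCount-replicate-E (suc P) _ ⟩
  northCount (replicate A N ++ replicate k E ++ N ∷ []) ≡⟨ northCount-replicate-N A _ ⟩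
  A + northCount (replicate k E ++ N ∷ [])             ≡⟨ cong (A +_) (northCount-replicate-E k (N ∷ [])) ⟩
  A + 1                                                ≡⟨ +-comm A 1 ⟩
  suc A                                                ∎

all-above-top : ∀ {i A} k → i < A → All (i <_) (replicate k A ++ A ∷ suc A ∷ [])
all-above-top k i<A = ++⁺ (replicate⁺ k i<A) (i<A ∷ m<n⇒m<1+n i<A ∷ [])

lastIndex-heights-below : ∀ P A k {i} → i < A → lastIndex i (heights P A k) ≡ just (suc P + i)
lastIndex-heights-below P A k {i} i<A = begin
  lastIndex i (heights P A k)
    ≡⟨ lastIndex-++-just i (replicate (suc P) 0) _ i
         (trans (lastIndex-++-nothing i (upTo A) _ (lastIndex-above (all-above-top k i<A))) (lastIndex-upTo i<A)) ⟩
  just (length (replicate (suc P) 0) + i) ≡⟨ cong (λ n → just (n + i)) (length-replicate (suc P)) ⟩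
  just (suc P + i)                        ∎

lastIndex-heights-top : ∀ P A k → lastIndex A (heights P A k) ≡ just (suc P + A + k)
lastIndex-heights-top P A k = begin
  lastIndex A (heights P A k)
    ≡⟨ lastIndex-++-just A (replicate (suc P) 0) _ _ (lastIndex-++-just A (upTo A) _ _
         (lastIndex-++-just A (replicate k A) _ 0 (lastIndex-∷ A (suc A ∷ []) (lastIndex-above (n<1+n A ∷ []))))) ⟩
  just (length (replicate (suc P) 0) + (length (upTo A) + (length (replicate k A) + 0)))
    ≡⟨ cong just (cong₂ _+_ (length-replicate (suc P)) (cong₂ _+_ (length-upTo A) (cong (_+ 0) (length-replicate k)))) ⟩
  just (suc P + (A + (k + 0)))
    ≡⟨ cong just (arith P A k) ⟩
  just (suc P + A + k) ∎
  where
  arith : ∀ P A k → suc P + (A + (k + 0)) ≡ suc P + A + k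
  arith = solve-∀

lastIndex-heights-top+1 : ∀ P A k → lastIndex (suc A) (heights P A k) ≡ just (suc (suc P + A + k))
lastIndex-heights-top+1 P A k = begin
  lastIndex (suc A) (heights P A k)
    ≡⟨ lastIndex-++-just (suc A) (replicate (suc P) 0) _ _ (lastIndex-++-just (suc A) (upTo A) _ _
         (lastIndex-++-just (suc A) (replicate k A) _ 1 last)) ⟩
  just (length (replicate (suc P) 0) + (length (upTo A) + (length (replicate k A) + 1)))
    ≡⟨ cong just (cong₂ _+_ (length-replicate (suc P)) (cong₂ _+_ (length-upTo A) (cong (_+ 1) (length-replicate k)))) ⟩
  just (suc P + (A + (k + 1)))
    ≡⟨ cong just (arith P A k) ⟩
  just (suc (suc P + A + k)) ∎
  where
  last : lastIndex (suc A) (A ∷ suc A ∷ []) ≡ just 1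
  last rewrite ≡ᵇ-refl A = refl
  arith : ∀ P A k → suc P + (A + (k + 1)) ≡ suc (suc P + A + k)
  arith = solve-∀

initVec-replicate-++ : ∀ x n ys {c} → count x ys ≡ suc c → initVec (replicate n x ++ ys) ≡ replicate n nothing ++ initVec ys
initVec-replicate-++ x zero    ys eq = refl
initVec-replicate-++ x (suc n) ys {c} eq rewrite count-replicate-++ x n ys | eq | +-suc n c =
  cong (nothing ∷_) (initVec-replicate-++ x n ys eq)

initVec-upTo-++ : ∀ n W → All (n ≤_) W → initVec (upTo n ++ W) ≡ map just (upTo n) ++ initVec W
initVec-upTo-++ zero    W _  = refl
initVec-upTo-++ (suc n) W ps = begin
  initVec (upTo (suc n) ++ W)               ≡⟨ cong (λ xs → initVec (xs ++ W)) (sym (upTo-∷ʳ n)) ⟩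
  initVec ((upTo n ++ n ∷ []) ++ W)         ≡⟨ cong initVec (++-assoc (upTo n) (n ∷ []) W) ⟩
  initVec (upTo n ++ n ∷ W)                 ≡⟨ initVec-upTo-++ n (n ∷ W) (≤-refl ∷ All.map <⇒≤ ps) ⟩
  map just (upTo n) ++ initVec (n ∷ W)      ≡⟨ cong (λ c → map just (upTo n) ++ (if c ≡ᵇ 0 then just n else nothing) ∷ initVec W)
                                                    (count-above ps) ⟩
  map just (upTo n) ++ just n ∷ initVec W   ≡⟨ sym (++-assoc (map just (upTo n)) (just n ∷ []) (initVec W)) ⟩
  (map just (upTo n) ++ just n ∷ []) ++ initVec W ≡⟨ cong (_++ initVec W) (sym (map-++ just (upTo n) (n ∷ []))) ⟩
  map just (upTo n ++ n ∷ []) ++ initVec W  ≡⟨ cong (λ xs → map just xs ++ initVec W) (upTo-∷ʳ n) ⟩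
  map just (upTo (suc n)) ++ initVec W      ∎

layout : ℕ → List (Maybe ℕ) → List ℕ → List (Maybe ℕ) → List (Maybe ℕ)
layout A X ms Y = (X ++ map just ms ++ Y) ++ map just (A ∷ suc A ∷ [])

initialLayout : ℕ → ℕ → ℕ → List (Maybe ℕ)
initialLayout P A k = layout A (replicate (suc P) nothing) (upTo A) (replicate k nothing)

initVec-heights : ∀ P A k → initVec (heights P A k) ≡ initialLayout P A k
initVec-heights P A k = begin
  initVec (replicate (suc P) 0 ++ upTo A ++ top)
    ≡⟨ initVec-replicate-++ 0 (suc P) (upTo A ++ top) (proj₂ (zeroAbove A)) ⟩
  replicate (suc P) nothing ++ initVec (upTo A ++ top)
    ≡⟨ cong (replicate (suc P) nothing ++_) (initVec-upTo-++ A top (++⁺ (replicate⁺ k ≤-refl) (≤-refl ∷ n≤1+n A ∷ []))) ⟩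
  replicate (suc P) nothing ++ map just (upTo A) ++ initVec top
    ≡⟨ cong (λ xs → replicate (suc P) nothing ++ map just (upTo A) ++ xs) (initVec-replicate-++ A k _ topCount) ⟩
  replicate (suc P) nothing ++ map just (upTo A) ++ replicate k nothing ++ initVec (A ∷ suc A ∷ [])
    ≡⟨ cong (λ xs → replicate (suc P) nothing ++ map just (upTo A) ++ replicate k nothing ++ xs) topInit ⟩
  replicate (suc P) nothing ++ map just (upTo A) ++ replicate k nothing ++ map just (A ∷ suc A ∷ [])
    ≡⟨ sym (++-assoc₃ (replicate (suc P) nothing) (map just (upTo A)) (replicate k nothing) _) ⟩
  initialLayout P A k ∎
  where
  top = replicate k A ++ A ∷ suc A ∷ []
  zeroAbove : ∀ A → ∃[ c ] count 0 (upTo A ++ replicate k A ++ A ∷ suc A ∷ []) ≡ suc c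
  zeroAbove zero    = k , trans (count-replicate-++ 0 k (0 ∷ 1 ∷ [])) (+-comm k 1)
  zeroAbove (suc A) = _ , refl
  topCount : count A (A ∷ suc A ∷ []) ≡ 1
  topCount rewrite ≡ᵇ-refl A | >⇒≡ᵇ-false (n<1+n A) = refl
  topInit : initVec (A ∷ suc A ∷ []) ≡ map just (A ∷ suc A ∷ [])
  topInit rewrite >⇒≡ᵇ-false (n<1+n A) = refl

hatStep : ℕ → ℕ → ℕ → Path → List (Maybe ℕ) → ℕ → List (Maybe ℕ)
hatStep P A k μ = bracketStep (ys (hatPath P A k)) (ys μ)

bracketVector-hatPath-steps : ∀ P A k μ → bracketVector (hatPath P A k) μ ≡
  hatStep P A k μ (hatStep P A k μ
    (foldl (hatStep P A k μ) (initialLayout P A k) (upTo A)) A) (suc A)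
bracketVector-hatPath-steps P A k μ = begin
  foldl step (initVec (ys (hatPath P A k))) (upTo (suc (northCount (hatPath P A k))))
    ≡⟨ cong₂ (λ v n → foldl step v (upTo (suc n)))
             (trans (cong initVec (ys-hatPath P A k)) (initVec-heights P A k)) (northCount-hatPath P A k) ⟩
  foldl step initial (upTo (suc (suc A)))
    ≡⟨ cong (foldl step initial) upTo-top ⟩
  foldl step initial (upTo A ++ A ∷ suc A ∷ [])
    ≡⟨ foldl-++ step initial (upTo A) (A ∷ suc A ∷ []) ⟩
  step (step (foldl step initial (upTo A)) A) (suc A) ∎
  where
  step = hatStep P A k μ
  initial = initialLayout P A k
  upTo-top : upTo (suc (suc A)) ≡ upTo A ++ A ∷ suc A ∷ []
  upTo-top = begin
    upTo (suc (suc A))                ≡⟨ sym (upTo-∷ʳ (suc A)) ⟩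
    upTo (suc A) ++ suc A ∷ []        ≡⟨ cong (_++ suc A ∷ []) (sym (upTo-∷ʳ A)) ⟩
    (upTo A ++ A ∷ []) ++ suc A ∷ []  ≡⟨ ++-assoc (upTo A) (A ∷ []) (suc A ∷ []) ⟩
    upTo A ++ A ∷ suc A ∷ []          ∎

hatStep-below : ∀ P A k μ X Y {i} → i < A → length X ≡ suc P →
  hatStep P A k μ (layout A X (upTo A) Y) i ≡ layout A (fillLast (count i (ys μ) ∸ 1) i X) (upTo A) Y
hatStep-below P A k μ X Y {i} i<A |X| = begin
  hatStep P A k μ (layout A X (upTo A) Y) i
    ≡⟨ cong (λ v → hatStep P A k μ v i) (regroup X) ⟩
  hatStep P A k μ ((X ++ map just (take i u)) ++ map just (drop i u) ++ Y ++ T) i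
    ≡⟨ bracketStep-at (ys (hatPath P A k)) (ys μ) (X ++ map just (take i u)) _ i fixed ⟩
  fillLast c i (X ++ map just (take i u)) ++ map just (drop i u) ++ Y ++ T
    ≡⟨ cong (_++ map just (drop i u) ++ Y ++ T) (fillLast-++-map-just c i X (take i u)) ⟩
  (fillLast c i X ++ map just (take i u)) ++ map just (drop i u) ++ Y ++ T
    ≡⟨ sym (regroup (fillLast c i X)) ⟩
  layout A (fillLast c i X) (upTo A) Y ∎
  where
  u = upTo A
  T = map just (A ∷ suc A ∷ [])
  c = count i (ys μ) ∸ 1
  regroup : ∀ Z → layout A Z u Y ≡ (Z ++ map just (take i u)) ++ map just (drop i u) ++ Y ++ T
  regroup Z = begin
    (Z ++ map just u ++ Y) ++ T
      ≡⟨ cong (λ xs → (Z ++ map just xs ++ Y) ++ T) (sym (take++drop≡id i u)) ⟩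
    (Z ++ map just (take i u ++ drop i u) ++ Y) ++ T
      ≡⟨ cong (λ xs → (Z ++ xs ++ Y) ++ T) (map-++ just (take i u) (drop i u)) ⟩
    (Z ++ (map just (take i u) ++ map just (drop i u)) ++ Y) ++ T
      ≡⟨ ++-assoc₃ Z _ Y T ⟩
    Z ++ (map just (take i u) ++ map just (drop i u)) ++ Y ++ T
      ≡⟨ cong (Z ++_) (++-assoc (map just (take i u)) _ _) ⟩
    Z ++ map just (take i u) ++ map just (drop i u) ++ Y ++ T
      ≡⟨ sym (++-assoc Z _ _) ⟩
    (Z ++ map just (take i u)) ++ map just (drop i u) ++ Y ++ T ∎
  fixed : lastIndex i (ys (hatPath P A k)) ≡ just (length (X ++ map just (take i u)))
  fixed = begin
    lastIndex i (ys (hatPath P A k))     ≡⟨ cong (lastIndex i) (ys-hatPath P A k) ⟩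
    lastIndex i (heights P A k)          ≡⟨ lastIndex-heights-below P A k i<A ⟩
    just (suc P + i)                     ≡⟨ cong just (sym (cong₂ _+_ |X| |take|)) ⟩
    just (length X + length (map just (take i u))) ≡⟨ cong just (sym (length-++ X)) ⟩
    just (length (X ++ map just (take i u))) ∎
    where
    |take| : length (map just (take i u)) ≡ i
    |take| = trans (length-map just (take i u))
                   (trans (length-take i u) (trans (cong (i ⊓_) (length-upTo A)) (m≤n⇒m⊓n≡m (<⇒≤ i<A))))

hatStep-top : ∀ P A k μ pre → length pre ≡ suc P + A + k →
  hatStep P A k μ (pre ++ map just (A ∷ suc A ∷ [])) A ≡ fillLast (count A (ys μ) ∸ 1) A pre ++ map just (A ∷ suc A ∷ [])
hatStep-top P A k μ pre |pre| = bracketStep-at (ys (hatPath P A k)) (ys μ) pre _ A (begin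
  lastIndex A (ys (hatPath P A k)) ≡⟨ cong (lastIndex A) (ys-hatPath P A k) ⟩
  lastIndex A (heights P A k)      ≡⟨ lastIndex-heights-top P A k ⟩
  just (suc P + A + k)             ≡⟨ cong just (sym |pre|) ⟩
  just (length pre)                ∎)

hatStep-top+1 : ∀ P A k μ pre → length pre ≡ suc P + A + k →
  hatStep P A k μ (pre ++ map just (A ∷ suc A ∷ [])) (suc A) ≡
    fillLast (count (suc A) (ys μ) ∸ 1) (suc A) pre ++ map just (A ∷ suc A ∷ [])
hatStep-top+1 P A k μ pre |pre| = begin
  hatStep P A k μ (pre ++ just A ∷ just (suc A) ∷ []) (suc A)
    ≡⟨ cong (λ v → hatStep P A k μ v (suc A)) (sym (++-assoc pre (just A ∷ []) (just (suc A) ∷ []))) ⟩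
  hatStep P A k μ ((pre ++ just A ∷ []) ++ just (suc A) ∷ []) (suc A)
    ≡⟨ bracketStep-at (ys (hatPath P A k)) (ys μ) (pre ++ just A ∷ []) _ (suc A) fixed ⟩
  fillLast c (suc A) (pre ++ map just (A ∷ [])) ++ just (suc A) ∷ []
    ≡⟨ cong (_++ just (suc A) ∷ []) (fillLast-++-map-just c (suc A) pre (A ∷ [])) ⟩
  (fillLast c (suc A) pre ++ just A ∷ []) ++ just (suc A) ∷ []
    ≡⟨ ++-assoc (fillLast c (suc A) pre) (just A ∷ []) (just (suc A) ∷ []) ⟩
  fillLast c (suc A) pre ++ just A ∷ just (suc A) ∷ [] ∎
  where
  c = count (suc A) (ys μ) ∸ 1
  fixed : lastIndex (suc A) (ys (hatPath P A k)) ≡ just (length (pre ++ just A ∷ []))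
  fixed = begin
    lastIndex (suc A) (ys (hatPath P A k)) ≡⟨ cong (lastIndex (suc A)) (ys-hatPath P A k) ⟩
    lastIndex (suc A) (heights P A k)      ≡⟨ lastIndex-heights-top+1 P A k ⟩
    just (suc (suc P + A + k))             ≡⟨ cong just (sym (trans (length-++ pre) (trans (+-comm _ 1) (cong suc |pre|)))) ⟩
    just (length (pre ++ just A ∷ []))     ∎

bracketVector-hatPath-filled : ∀ P A k μ n ms {m e} →
  foldl (hatStep P A k μ) (initialLayout P A k) (upTo A) ≡ layout A (replicate n nothing) ms (replicate k nothing) →
  n + length ms ≡ suc P + A →
  count A (ys μ) ≡ suc m → count (suc A) (ys μ) ≡ suc e → m + e ≡ n + k →
  ∀ α β → α ++ β ≡ replicate e (suc A) ++ replicate m A → length α ≡ n →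
  bracketVector (hatPath P A k) μ ≡ map just (α ++ ms ++ β ++ A ∷ suc A ∷ [])
bracketVector-hatPath-filled P A k μ n ms {m} {e} low |ms| #A #A+1 m+e α β α++β |α| = begin
  bracketVector (hatPath P A k) μ
    ≡⟨ bracketVector-hatPath-steps P A k μ ⟩
  step (step (foldl step _ (upTo A)) A) (suc A)
    ≡⟨ cong (λ v → step (step v A) (suc A)) low ⟩
  step (step (pre ++ T) A) (suc A)
    ≡⟨ cong (λ v → step v (suc A)) (hatStep-top P A k μ pre |pre|) ⟩
  step (fillLast (count A (ys μ) ∸ 1) A pre ++ T) (suc A)
    ≡⟨ hatStep-top+1 P A k μ _ (trans (length-fillLast (count A (ys μ) ∸ 1) A pre) |pre|) ⟩
  fillLast (count (suc A) (ys μ) ∸ 1) (suc A) (fillLast (count A (ys μ) ∸ 1) A pre) ++ T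
    ≡⟨ cong₂ (λ c₁ c₂ → fillLast (c₂ ∸ 1) (suc A) (fillLast (c₁ ∸ 1) A pre) ++ T) #A #A+1 ⟩
  fillLast e (suc A) (fillLast m A pre) ++ T
    ≡⟨ cong (_++ T) (fillLast-twice-insert m e A (suc A) (replicate n nothing) ms (replicate k nothing) α β filled
                       (trans |α| (sym (length-replicate n)))) ⟩
  map just (α ++ ms ++ β) ++ T
    ≡⟨ sym (map-++ just (α ++ ms ++ β) _) ⟩
  map just ((α ++ ms ++ β) ++ A ∷ suc A ∷ [])
    ≡⟨ cong (map just) (++-assoc₃ α ms β _) ⟩
  map just (α ++ ms ++ β ++ A ∷ suc A ∷ []) ∎
  where
  step = hatStep P A k μ
  T = map just (A ∷ suc A ∷ [])
  pre = replicate n nothing ++ map just ms ++ replicate k nothing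
  |pre| : length pre ≡ suc P + A + k
  |pre| = trans (length-holes-around n ms k) (cong (_+ k) |ms|)
  filled : fillLast e (suc A) (fillLast m A (replicate n nothing ++ replicate k nothing)) ≡ map just (α ++ β)
  filled = begin
    fillLast e (suc A) (fillLast m A (replicate n nothing ++ replicate k nothing))
      ≡⟨ cong (λ xs → fillLast e (suc A) (fillLast m A xs))
              (trans (sym (replicate-+ n k nothing)) (cong (λ j → replicate j nothing) (sym m+e))) ⟩
    fillLast e (suc A) (fillLast m A (replicate (m + e) nothing)) ≡⟨ fillLast-twice-replicate m e A (suc A) ⟩
    map just (replicate e (suc A) ++ replicate m A)               ≡⟨ cong (map just) (sym α++β) ⟩
    map just (α ++ β)                                             ∎

-- ν-paths

finalRise : ℕ → ℕ → Path
finalRise m e = replicate m E ++ N ∷ replicate e E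

latePath : ℕ → ℕ → ℕ → Path
latePath A m e = replicate A N ++ finalRise m e

earlyPath : ℕ → ℕ → ℕ → ℕ → Path
earlyPath j u m e = replicate j N ++ E ∷ latePath (suc u) m e

count-ys-replicate-N-below : ∀ {i n} q → i < n → count i (ys (replicate n N ++ q)) ≡ 1
count-ys-replicate-N-below {zero}  {suc n} q _         = cong suc (count-zero-map-suc (ys (replicate n N ++ q)))
count-ys-replicate-N-below {suc i} {suc n} q (s≤s i<n) =
  trans (count-map-suc i (ys (replicate n N ++ q))) (count-ys-replicate-N-below q i<n)

count-ys-replicate-N-above : ∀ n i q → count (n + i) (ys (replicate n N ++ q)) ≡ count i (ys q)
count-ys-replicate-N-above zero    i q = refl
count-ys-replicate-N-above (suc n) i q =
  trans (count-map-suc (n + i) (ys (replicate n N ++ q))) (count-ys-replicate-N-above n i q)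

count-ys-replicate-E : ∀ e → count 0 (ys (replicate e E)) ≡ suc e
count-ys-replicate-E zero    = refl
count-ys-replicate-E (suc e) = cong suc (count-ys-replicate-E e)

count-ys-finalRise-0 : ∀ m e → count 0 (ys (finalRise m e)) ≡ suc m
count-ys-finalRise-0 zero    e = cong suc (count-zero-map-suc (ys (replicate e E)))
count-ys-finalRise-0 (suc m) e = cong suc (count-ys-finalRise-0 m e)

count-ys-finalRise-1 : ∀ m e → count 1 (ys (finalRise m e)) ≡ suc e
count-ys-finalRise-1 zero    e = trans (count-map-suc 0 (ys (replicate e E))) (count-ys-replicate-E e)
count-ys-finalRise-1 (suc m) e = count-ys-finalRise-1 m e

count-latePath-top : ∀ A m e → count A (ys (latePath A m e)) ≡ suc m
count-latePath-top A m e = begin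
  count A (ys μ)                  ≡⟨ cong (λ i → count i (ys μ)) (sym (+-identityʳ A)) ⟩
  count (A + 0) (ys μ)            ≡⟨ count-ys-replicate-N-above A 0 (finalRise m e) ⟩
  count 0 (ys (finalRise m e))    ≡⟨ count-ys-finalRise-0 m e ⟩
  suc m                           ∎
  where μ = latePath A m e

count-latePath-top+1 : ∀ A m e → count (suc A) (ys (latePath A m e)) ≡ suc e
count-latePath-top+1 A m e = begin
  count (suc A) (ys μ)            ≡⟨ cong (λ i → count i (ys μ)) (+-comm 1 A) ⟩
  count (A + 1) (ys μ)            ≡⟨ count-ys-replicate-N-above A 1 (finalRise m e) ⟩
  count 1 (ys (finalRise m e))    ≡⟨ count-ys-finalRise-1 m e ⟩
  suc e                           ∎
  where μ = latePath A m e

count-earlyPath-shifted : ∀ j u m e i → count (j + suc i) (ys (earlyPath j u m e)) ≡ count (suc i) (ys (latePath (suc u) m e))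
count-earlyPath-shifted j u m e i = count-ys-replicate-N-above j (suc i) (E ∷ latePath (suc u) m e)

count-earlyPath-dip : ∀ j u m e → count j (ys (earlyPath j u m e)) ≡ 2
count-earlyPath-dip j u m e = begin
  count j (ys μ)                         ≡⟨ cong (λ i → count i (ys μ)) (sym (+-identityʳ j)) ⟩
  count (j + 0) (ys μ)                   ≡⟨ count-ys-replicate-N-above j 0 (E ∷ latePath (suc u) m e) ⟩
  suc (count 0 (ys (latePath (suc u) m e))) ≡⟨ cong suc (count-ys-replicate-N-below {n = suc u} (finalRise m e) (s≤s z≤n)) ⟩
  2                                      ∎
  where μ = earlyPath j u m e

count-earlyPath-other : ∀ j u m e {i} → i < j + suc u → i ≢ j → count i (ys (earlyPath j u m e)) ≤ 1
count-earlyPath-other j u m e {i} i<A i≢j with <-cmp i j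
... | tri< i<j _ _ = ≤-reflexive (count-ys-replicate-N-below (E ∷ latePath (suc u) m e) i<j)
... | tri≈ _ i≡j _ = ⊥-elim (i≢j i≡j)
... | tri> _ _ j<i with m≤n⇒∃[o]m+o≡n j<i
...   | d , refl = ≤-reflexive (begin
  count (suc j + d) (ys μ)                        ≡⟨ cong (λ i → count i (ys μ)) (sym (+-suc j d)) ⟩
  count (j + suc d) (ys μ)                        ≡⟨ count-earlyPath-shifted j u m e d ⟩
  count (suc d) (ys (latePath (suc u) m e))       ≡⟨ count-ys-replicate-N-below (finalRise m e) (+-cancelˡ-< j _ _ d<u) ⟩
  1                                               ∎)
  where
  μ = earlyPath j u m e
  d<u : j + suc d < j + suc u
  d<u = subst (_< j + suc u) (sym (+-suc j d)) i<A

count-earlyPath-top : ∀ j u m e → count (j + suc u) (ys (earlyPath j u m e)) ≡ suc m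
count-earlyPath-top j u m e = trans (count-earlyPath-shifted j u m e u) (count-latePath-top (suc u) m e)

count-earlyPath-top+1 : ∀ j u m e → count (suc (j + suc u)) (ys (earlyPath j u m e)) ≡ suc e
count-earlyPath-top+1 j u m e = begin
  count (suc (j + suc u)) (ys μ)                  ≡⟨ cong (λ i → count i (ys μ)) (sym (+-suc j (suc u))) ⟩
  count (j + suc (suc u)) (ys μ)                  ≡⟨ count-earlyPath-shifted j u m e (suc u) ⟩
  count (suc (suc u)) (ys (latePath (suc u) m e)) ≡⟨ count-latePath-top+1 (suc u) m e ⟩
  suc e                                           ∎
  where μ = earlyPath j u m e

-- A ν-path for ν = E N^A E^b' N either begins with N^A, or takes its first east
-- step at a height j < A.
data NuPathForm (b' : ℕ) : ℕ → Path → Set where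
  early : ∀ j u m e → m + e ≡ b' → NuPathForm b' (j + suc u) (earlyPath j u m e)
  late  : ∀ A m e → m + e ≡ suc b' → NuPathForm b' A (latePath A m e)

northCount-take : ∀ n p → northCount (take n p) ≤ n
northCount-take zero    p       = z≤n
northCount-take (suc n) []      = z≤n
northCount-take (suc n) (N ∷ p) = s≤s (northCount-take n p)
northCount-take (suc n) (E ∷ p) = m≤n⇒m≤1+n (northCount-take n p)

north-prefix : ∀ n p → n ≤ northCount (take n p) → ∃[ q ] p ≡ replicate n N ++ q
north-prefix zero    p       _         = p , refl
north-prefix (suc n) (N ∷ p) (s≤s n≤) with north-prefix n p n≤
... | q , refl = q , refl
north-prefix (suc n) (E ∷ p) 1+n≤     = ⊥-elim (<⇒≱ (s≤s (northCount-take n p)) 1+n≤)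

first-east : ∀ n p → n ≤ northCount (take (suc n) p) →
  (∃[ q ] p ≡ replicate n N ++ q) ⊎ (∃[ j ] ∃[ u ] ∃[ q ] (j + suc u ≡ n × p ≡ replicate j N ++ E ∷ replicate (suc u) N ++ q))
first-east zero    p       _          = inj₁ (p , refl)
first-east (suc n) (N ∷ p) (s≤s n≤)  with first-east n p n≤
... | inj₁ (q , refl)               = inj₁ (q , refl)
... | inj₂ (j , u , q , refl , refl) = inj₂ (suc j , u , q , refl , refl)
first-east (suc n) (E ∷ p) 1+n≤      with north-prefix (suc n) p 1+n≤
... | q , refl                      = inj₂ (0 , n , q , refl , refl)

east-only : ∀ q → northCount q ≡ 0 → q ≡ replicate (eastCount q) E
east-only []      _  = refl
east-only (E ∷ q) eq = cong (E ∷_) (east-only q eq)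

single-north : ∀ q → northCount q ≡ 1 → ∃[ m ] ∃[ e ] (q ≡ finalRise m e × m + e ≡ eastCount q)
single-north (N ∷ q) eq with east-only q (suc-injective eq)
... | q≡ = 0 , eastCount q , cong (N ∷_) q≡ , refl
single-north (E ∷ q) eq with single-north q eq
... | m , e , refl , m+e = suc m , e , refl , cong suc m+e

northCount-nu : ∀ A b' → northCount (nu (suc A) (suc b')) ≡ A + 1
northCount-nu A b' = trans (northCount-replicate-N A _) (cong (A +_) (northCount-replicate-E b' (N ∷ [])))

eastCount-nu : ∀ A b' → eastCount (nu (suc A) (suc b')) ≡ suc b'
eastCount-nu A b' = cong suc (trans (eastCount-replicate-N A _) (trans (eastCount-replicate-E b' (N ∷ [])) (+-identityʳ b')))

northCount-take-replicate-N : ∀ n q → northCount (take n (replicate n N ++ q)) ≡ n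
northCount-take-replicate-N zero    q = refl
northCount-take-replicate-N (suc n) q = cong suc (northCount-take-replicate-N n q)

nuPathForm-late : ∀ A b' q → northCount (replicate A N ++ q) ≡ A + 1 → eastCount (replicate A N ++ q) ≡ suc b' →
  NuPathForm b' A (replicate A N ++ q)
nuPathForm-late A b' q #N #E
  with single-north q (+-cancelˡ-≡ A _ _ (trans (sym (northCount-replicate-N A q)) #N))
... | m , e , refl , m+e = late A m e (trans m+e (trans (sym (eastCount-replicate-N A _)) #E))

nuPathForm-early : ∀ j u b' q → northCount (replicate j N ++ E ∷ replicate (suc u) N ++ q) ≡ j + suc u + 1 →
  eastCount (replicate j N ++ E ∷ replicate (suc u) N ++ q) ≡ suc b' →
  NuPathForm b' (j + suc u) (replicate j N ++ E ∷ replicate (suc u) N ++ q)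
nuPathForm-early j u b' q #N #E with single-north q #N-q
  where
  #N-q : northCount q ≡ 1
  #N-q = +-cancelˡ-≡ (j + suc u) _ _ (begin
    j + suc u + northCount q                               ≡⟨ +-assoc j (suc u) _ ⟩
    j + (suc u + northCount q)                             ≡⟨ cong (j +_) (sym (northCount-replicate-N (suc u) q)) ⟩
    j + northCount (E ∷ replicate (suc u) N ++ q)          ≡⟨ sym (northCount-replicate-N j _) ⟩
    northCount (replicate j N ++ E ∷ replicate (suc u) N ++ q) ≡⟨ #N ⟩
    j + suc u + 1                                          ∎)
... | m , e , refl , m+e = early j u m e (trans m+e (suc-injective (begin
  suc (eastCount (finalRise m e))                             ≡⟨ cong suc (sym (eastCount-replicate-N (suc u) _)) ⟩
  eastCount (E ∷ latePath (suc u) m e)                        ≡⟨ sym (eastCount-replicate-N j _) ⟩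
  eastCount (earlyPath j u m e)                               ≡⟨ #E ⟩
  suc b'                                                      ∎)))

nuPathForm : ∀ A b' μ → IsPathAbove (nu (suc A) (suc b')) μ → NuPathForm b' A μ
nuPathForm A b' μ (#N , #E , above) with first-east A μ A≤
  where
  A≤ : A ≤ northCount (take (suc A) μ)
  A≤ = subst (_≤ northCount (take (suc A) μ)) (northCount-take-replicate-N A _) (above (suc A))
... | inj₁ (q , refl) = nuPathForm-late A b' q (trans #N (northCount-nu A b')) (trans #E (eastCount-nu A b'))
... | inj₂ (j , u , q , refl , refl) = nuPathForm-early j u b' q (trans #N (northCount-nu A b')) (trans #E (eastCount-nu A b'))

bracketVector-latePath : ∀ P A k m e → m + e ≡ suc (P + k) →
  ∀ α s β → α ++ s ∷ β ≡ replicate e (suc A) ++ replicate m A → length α ≡ P →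
  bracketVector (hatPath P A k) (latePath A m e) ≡ map just (α ++ s ∷ upTo A ++ β ++ A ∷ suc A ∷ [])
bracketVector-latePath P A k m e m+e α s β split |α| = begin
  bracketVector (hatPath P A k) μ
    ≡⟨ bracketVector-hatPath-filled P A k μ (suc P) (upTo A) low (cong (suc P +_) (length-upTo A))
         (count-latePath-top A m e) (count-latePath-top+1 A m e) m+e (α ++ s ∷ []) β
         (trans (++-assoc α (s ∷ []) β) split) |α++s| ⟩
  map just ((α ++ s ∷ []) ++ upTo A ++ β ++ A ∷ suc A ∷ [])
    ≡⟨ cong (map just) (++-assoc α (s ∷ []) _) ⟩
  map just (α ++ s ∷ upTo A ++ β ++ A ∷ suc A ∷ []) ∎
  where
  μ = latePath A m e
  low = foldl-upTo-inert (hatStep P A k μ) _ A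
          (λ i i<A w → bracketStep-inert (ys (hatPath P A k)) (ys μ) w i (≤-reflexive (count-ys-replicate-N-below (finalRise m e) i<A)))
  |α++s| : length (α ++ s ∷ []) ≡ suc P
  |α++s| = trans (length-++ α) (trans (+-comm (length α) 1) (cong suc |α|))

bracketVector-earlyPath : ∀ P j u k m e → m + e ≡ P + k →
  ∀ α β → α ++ β ≡ replicate e (suc (j + suc u)) ++ replicate m (j + suc u) → length α ≡ P →
  bracketVector (hatPath P (j + suc u) k) (earlyPath j u m e)
    ≡ map just (α ++ j ∷ upTo (j + suc u) ++ β ++ j + suc u ∷ suc (j + suc u) ∷ [])
bracketVector-earlyPath P j u k m e m+e α β split |α| =
  bracketVector-hatPath-filled P A k μ P (j ∷ upTo A) low |ms|
    (count-earlyPath-top j u m e) (count-earlyPath-top+1 j u m e) m+e α β split |α|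
  where
  A = j + suc u
  μ = earlyPath j u m e
  step = hatStep P A k μ
  Y = replicate k nothing
  j<A : j < A
  j<A = m<m+n j (s≤s z≤n)
  low : foldl step (initialLayout P A k) (upTo A) ≡ layout A (replicate P nothing) (j ∷ upTo A) Y
  low = begin
    foldl step (initialLayout P A k) (upTo A)
      ≡⟨ foldl-upTo-single step _ A j<A
           (λ i i<A i≢j w → bracketStep-inert (ys (hatPath P A k)) (ys μ) w i (count-earlyPath-other j u m e i<A i≢j)) ⟩
    step (initialLayout P A k) j
      ≡⟨ hatStep-below P A k μ (replicate (suc P) nothing) Y j<A (length-replicate (suc P)) ⟩
    layout A (fillLast (count j (ys μ) ∸ 1) j (replicate (suc P) nothing)) (upTo A) Y
      ≡⟨ cong (λ c → layout A (fillLast (c ∸ 1) j (replicate (suc P) nothing)) (upTo A) Y) (count-earlyPath-dip j u m e) ⟩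
    layout A (fillLast 1 j (replicate (1 + P) nothing)) (upTo A) Y
      ≡⟨ cong (λ X → layout A X (upTo A) Y) (fillLast-replicate 1 P j) ⟩
    layout A (replicate P nothing ++ just j ∷ []) (upTo A) Y
      ≡⟨ cong (_++ map just (A ∷ suc A ∷ [])) (++-assoc (replicate P nothing) (just j ∷ []) _) ⟩
    layout A (replicate P nothing) (j ∷ upTo A) Y ∎
  |ms| : P + suc (length (upTo A)) ≡ suc P + A
  |ms| = trans (+-suc P _) (cong (suc P +_) (length-upTo A))

record BracketForm (P A k : ℕ) (μ : Path) : Set where
  field
    s t              : ℕ
    α β              : List ℕ
    s≤1+A            : s ≤ suc A
    |α|≡P            : length α ≡ P
    |β|≡k            : length β ≡ k
    α++β≡            : α ++ β ≡ replicate t (suc A) ++ replicate (P + k ∸ t) A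
    t≤P+k            : t ≤ P + k
    s≡A⇒t≤P          : s ≡ A → t ≤ P
    s≡1+A⇒P≤t        : s ≡ suc A → P ≤ t
    bracketVector≡   : bracketVector (hatPath P A k) μ ≡ map just (α ++ s ∷ upTo A ++ β ++ A ∷ suc A ∷ [])

bracketForm-early : ∀ P j u k m e → m + e ≡ P + k → BracketForm P (j + suc u) k (earlyPath j u m e)
bracketForm-early P j u k m e m+e = record
  { s = j ; t = e ; α = take P w ; β = drop P w
  ; s≤1+A = m≤n⇒m≤1+n (<⇒≤ j<A)
  ; |α|≡P = |α|
  ; |β|≡k = trans (length-drop P w) (trans (cong (_∸ P) |w|) (m+n∸m≡n P k))
  ; α++β≡ = trans (take++drop≡id P w) (cong (λ n → replicate e (suc A) ++ replicate n A) m≡)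
  ; t≤P+k = subst (e ≤_) m+e (m≤n+m e m)
  ; s≡A⇒t≤P = λ j≡A → ⊥-elim (<⇒≢ j<A j≡A)
  ; s≡1+A⇒P≤t = λ j≡1+A → ⊥-elim (<⇒≢ (m<n⇒m<1+n j<A) j≡1+A)
  ; bracketVector≡ = bracketVector-earlyPath P j u k m e m+e (take P w) (drop P w) (take++drop≡id P w) |α|
  }
  where
  A = j + suc u
  w = replicate e (suc A) ++ replicate m A
  j<A : j < A
  j<A = m<m+n j (s≤s z≤n)
  |w| : length w ≡ P + k
  |w| = trans (length-++ (replicate e (suc A))) (trans (cong₂ _+_ (length-replicate e) (length-replicate m)) (trans (+-comm e m) m+e))
  |α| : length (take P w) ≡ P
  |α| = trans (length-take P w) (trans (cong (P ⊓_) |w|) (m≤n⇒m⊓n≡m (m≤m+n P k)))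
  m≡ : m ≡ P + k ∸ e
  m≡ = trans (sym (m+n∸n≡m m e)) (cong (_∸ e) m+e)

bracketForm-late-low : ∀ e d A k → BracketForm (e + d) A k (latePath A (suc (d + k)) e)
bracketForm-late-low e d A k = record
  { s = A ; t = e ; α = α ; β = replicate k A
  ; s≤1+A = n≤1+n A
  ; |α|≡P = |α|
  ; |β|≡k = length-replicate k
  ; α++β≡ = begin
      (replicate e (suc A) ++ replicate d A) ++ replicate k A ≡⟨ ++-assoc (replicate e (suc A)) _ _ ⟩
      replicate e (suc A) ++ replicate d A ++ replicate k A   ≡⟨ cong (replicate e (suc A) ++_) (sym (replicate-+ d k A)) ⟩
      replicate e (suc A) ++ replicate (d + k) A              ≡⟨ cong (λ n → replicate e (suc A) ++ replicate n A) d+k≡ ⟩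
      replicate e (suc A) ++ replicate (e + d + k ∸ e) A      ∎
  ; t≤P+k = ≤-trans (m≤m+n e d) (m≤m+n (e + d) k)
  ; s≡A⇒t≤P = λ _ → m≤m+n e d
  ; s≡1+A⇒P≤t = λ A≡1+A → ⊥-elim (1+n≢n (sym A≡1+A))
  ; bracketVector≡ = bracketVector-latePath (e + d) A k (suc (d + k)) e (arith e d k) α A (replicate k A) split |α|
  }
  where
  α = replicate e (suc A) ++ replicate d A
  |α| : length α ≡ e + d
  |α| = trans (length-++ (replicate e (suc A))) (cong₂ _+_ (length-replicate e) (length-replicate d))
  arith : ∀ e d k → suc (d + k) + e ≡ suc (e + d + k)
  arith = solve-∀
  d+k≡ : d + k ≡ e + d + k ∸ e
  d+k≡ = sym (trans (cong (_∸ e) (+-assoc e d k)) (m+n∸m≡n e (d + k)))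
  split : α ++ A ∷ replicate k A ≡ replicate e (suc A) ++ replicate (suc (d + k)) A
  split = begin
    (replicate e (suc A) ++ replicate d A) ++ A ∷ replicate k A ≡⟨ ++-assoc (replicate e (suc A)) _ _ ⟩
    replicate e (suc A) ++ replicate d A ++ replicate (suc k) A ≡⟨ cong (replicate e (suc A) ++_) (sym (replicate-+ d (suc k) A)) ⟩
    replicate e (suc A) ++ replicate (d + suc k) A              ≡⟨ cong (λ n → replicate e (suc A) ++ replicate n A) (+-suc d k) ⟩
    replicate e (suc A) ++ replicate (suc (d + k)) A            ∎

bracketForm-late-high : ∀ P d A m → BracketForm P A (d + m) (latePath A m (suc P + d))
bracketForm-late-high P d A m = record
  { s = suc A ; t = P + d ; α = replicate P (suc A) ; β = β
  ; s≤1+A = ≤-refl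
  ; |α|≡P = length-replicate P
  ; |β|≡k = trans (length-++ (replicate d (suc A))) (cong₂ _+_ (length-replicate d) (length-replicate m))
  ; α++β≡ = begin
      replicate P (suc A) ++ replicate d (suc A) ++ replicate m A ≡⟨ sym (++-assoc (replicate P (suc A)) _ _) ⟩
      (replicate P (suc A) ++ replicate d (suc A)) ++ replicate m A ≡⟨ cong (_++ replicate m A) (sym (replicate-+ P d (suc A))) ⟩
      replicate (P + d) (suc A) ++ replicate m A                  ≡⟨ cong (λ n → replicate (P + d) (suc A) ++ replicate n A) m≡ ⟩
      replicate (P + d) (suc A) ++ replicate (P + (d + m) ∸ (P + d)) A ∎
  ; t≤P+k = +-monoʳ-≤ P (m≤m+n d m)
  ; s≡A⇒t≤P = λ 1+A≡A → ⊥-elim (1+n≢n 1+A≡A)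
  ; s≡1+A⇒P≤t = λ _ → m≤m+n P d
  ; bracketVector≡ = bracketVector-latePath P A (d + m) m (suc P + d) (arith P d m) (replicate P (suc A)) (suc A) β split
                                            (length-replicate P)
  }
  where
  β = replicate d (suc A) ++ replicate m A
  arith : ∀ P d m → m + (suc P + d) ≡ suc (P + (d + m))
  arith = solve-∀
  m≡ : m ≡ P + (d + m) ∸ (P + d)
  m≡ = sym (trans (cong (_∸ (P + d)) (sym (+-assoc P d m))) (m+n∸m≡n (P + d) m))
  split : replicate P (suc A) ++ suc A ∷ β ≡ replicate (suc P + d) (suc A) ++ replicate m A
  split = begin
    replicate P (suc A) ++ replicate (suc d) (suc A) ++ replicate m A ≡⟨ sym (++-assoc (replicate P (suc A)) _ _) ⟩
    (replicate P (suc A) ++ replicate (suc d) (suc A)) ++ replicate m A ≡⟨ cong (_++ replicate m A) (sym (replicate-+ P (suc d) (suc A))) ⟩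
    replicate (P + suc d) (suc A) ++ replicate m A                      ≡⟨ cong (λ n → replicate n (suc A) ++ replicate m A) (+-suc P d) ⟩
    replicate (suc P + d) (suc A) ++ replicate m A                      ∎

bracketForm-late : ∀ P A k m e → m + e ≡ suc (P + k) → BracketForm P A k (latePath A m e)
bracketForm-late P A k m e m+e with ≤-<-connex e P
... | inj₁ e≤P with m≤n⇒∃[o]m+o≡n e≤P
...   | d , refl = subst (λ m → BracketForm (e + d) A k (latePath A m e)) (sym m≡) (bracketForm-late-low e d A k)
  where
  arith : ∀ e d k → suc (e + d + k) ≡ suc (d + k) + e
  arith = solve-∀
  m≡ : m ≡ suc (d + k)
  m≡ = +-cancelʳ-≡ e m _ (trans m+e (arith e d k))
bracketForm-late P A k m e m+e | inj₂ P<e with m≤n⇒∃[o]m+o≡n P<e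
...   | d , refl = subst (λ k → BracketForm P A k (latePath A m (suc P + d))) (sym k≡) (bracketForm-late-high P d A m)
  where
  arith : ∀ P d m → m + (suc P + d) ≡ suc (P + (d + m))
  arith = solve-∀
  k≡ : k ≡ d + m
  k≡ = +-cancelˡ-≡ P k _ (suc-injective (trans (sym m+e) (arith P d m)))

bracketForm : ∀ P A k μ → IsPathAbove (nu (suc A) (suc (P + k))) μ → BracketForm P A k μ
bracketForm P A k μ above with nuPathForm A (P + k) μ above
... | early j u m e m+e = bracketForm-early P j u k m e m+e
... | late A m e m+e    = bracketForm-late P A k m e m+e

lemma3p2 : (a b k : ℕ) → 1 ≤ a → 1 ≤ b → k ≤ b ∸ 1 → (a ≡ 1 → k ≡ 0) →
    (μ : Path) → IsPathAbove (nu a b) μ →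
    (1 < a →
      ∃[ s ] ∃[ t ] ∃[ α ] ∃[ β ]
        (s ≤ a × length α ≡ b ∸ k ∸ 1 × length β ≡ k ×
         α ++ β ≡ replicate t a ++ replicate (b ∸ 1 ∸ t) (a ∸ 1) ×
         (s ≡ a ∸ 1 → t ≤ b ∸ 1 ∸ k) ×
         (s ≡ a → b ∸ 1 ∸ k ≤ t × t ≤ b ∸ 1) ×
         (s ≤ a ∸ 2 → t ≤ b ∸ 1) ×
         bracketVector (nuHat a b k) μ
           ≡ map just (α ++ s ∷ upTo (a ∸ 1) ++ β ++ (a ∸ 1) ∷ a ∷ []))) ×
    (a ≡ 1 →
      ∃[ s ] ∃[ t ] ∃[ γ ]
        (s ≤ 1 × length γ ≡ b ∸ 1 ×
         γ ≡ replicate t 1 ++ replicate (b ∸ 1 ∸ t) 0 ×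
         (s ≡ 1 → t ≡ b ∸ 1) ×
         (s ≡ 0 → t ≤ b ∸ 1) ×
         bracketVector (nuHat a b k) μ ≡ map just (γ ++ s ∷ 0 ∷ 1 ∷ [])))
lemma3p2 (suc zero) (suc b') k _ _ _ a≡1⇒k≡0 μ above with a≡1⇒k≡0 refl
... | refl = (λ { (s≤s ()) }) ,
             (λ _ → s , t , α , s≤1+A , |α|≡P , γ≡ , (λ s≡1 → ≤-antisym t≤b' (s≡1+A⇒P≤t s≡1)) , (λ _ → t≤b') , vector)
  where
  open BracketForm (bracketForm b' 0 0 μ (subst (λ n → IsPathAbove (nu 1 (suc n)) μ) (sym (+-identityʳ b')) above))
  β≡[] : β ≡ []
  β≡[] = length≡0⇒[] β |β|≡k
  t≤b' : t ≤ b'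
  t≤b' = subst (t ≤_) (+-identityʳ b') t≤P+k
  γ≡ : α ≡ replicate t 1 ++ replicate (b' ∸ t) 0
  γ≡ = trans (sym (trans (cong (α ++_) β≡[]) (++-identityʳ α)))
             (trans α++β≡ (cong (λ n → replicate t 1 ++ replicate (n ∸ t) 0) (+-identityʳ b')))
  vector : bracketVector (hatPath b' 0 0) μ ≡ map just (α ++ s ∷ 0 ∷ 1 ∷ [])
  vector = trans bracketVector≡ (cong (λ β → map just (α ++ s ∷ β ++ 0 ∷ 1 ∷ [])) β≡[])
-- Abstracting b' ∸ k as P also turns b ∸ 1 ∸ k into P.
lemma3p2 (suc (suc A)) (suc b') k _ _ k≤b' _ μ above with b' ∸ k | m∸n+n≡m k≤b'
... | P | refl rewrite m+n∸n≡m (suc P) k =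
  (λ _ → s , t , α , β , s≤1+A , |α|≡P , |β|≡k , α++β≡ , s≡A⇒t≤P , (λ s≡a → s≡1+A⇒P≤t s≡a , t≤P+k) , (λ _ → t≤P+k) , bracketVector≡) ,
  (λ ())
  where open BracketForm (bracketForm P (suc A) k μ above)
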